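{- Let $G_1$ and $G_2$ be vertex-disjoint finite connected graphs with $n_1$ and $n_2$ vertices and distance matrices $D_1,D_2$. Suppose $G_1$ and $G_2$ have nonnegative curvature, i.e. $D_iw_i=n_i\cdot\mathbf{1}$ for some $w_i\in\mathbb{R}^{n_i}_{\geq 0}$, $i=1,2$. Let $G$ be the graph obtained from the disjoint union of $G_1$ and $G_2$ by adding one edge $e=\{u,v\}$ with $u\in V(G_1)$, $v\in V(G_2)$. Then $G$ has a curvature $w$ (i.e. $D_Gw=(n_1+n_2)\cdot\mathbf{1}$, where $D_G$ is the distance matrix of $G$) such that $w(u)\leq 0$, $w(v)\leq 0$, and $w(x)\geq 0$ for every other vertex $x$ of $G$.
   Context: For a finite connected graph with vertices $v_1,\dots,v_n$, the distance matrix is $D_{ij}=d(v_i,v_j)$ (shortest-path distance), $\mathbf{1}$ is the all-ones vector, and a curvature is a vector $w\in\mathbb{R}^n$, viewed as a function on vertices, with $Dw=n\cdot\mathbf{1}$.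
   Formalization: The nonnegative curvatures w₁, w₂ of G₁, G₂ and the curvature w of G are taken in ℚ rather than ℝ. -}

module Defs where

open import Data.Nat using (ℕ; zero; suc) renaming (_+_ to _+ℕ_; _≤_ to _≤ℕ_)
open import Data.Fin using (Fin; zero; suc; splitAt; _↑ˡ_; _↑ʳ_)
open import Data.Integer using (+_)
open import Data.Rational using (ℚ; 0ℚ; _+_; _*_; _/_)
open import Data.Product using (Σ; ∃; _×_; _,_)
open import Data.Sum using (inj₁; inj₂)
open import Relation.Binary.PropositionalEquality using (_≡_)
open import Relation.Nullary using (¬_)

record Graph (n : ℕ) : Set₁ where
  field
    Adj     : Fin n → Fin n → Set
    symm    : ∀ {i j} → Adj i j → Adj j i
    irrefl  : ∀ {i} → ¬ Adj i i

open Graph public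

data Walk {n : ℕ} (G : Graph n) : Fin n → Fin n → ℕ → Set where
  nil  : ∀ {i} → Walk G i i 0
  cons : ∀ {i j k l} → Adj G i j → Walk G j k l → Walk G i k (suc l)

Connected : ∀ {n} → Graph n → Set
Connected G = ∀ i j → ∃ λ l → Walk G i j l

IsDistanceMatrix : ∀ {n} → Graph n → (Fin n → Fin n → ℕ) → Set
IsDistanceMatrix G d =
  ∀ i j → Walk G i j (d i j) × (∀ l → Walk G i j l → d i j ≤ℕ l)

ℕ→ℚ : ℕ → ℚ
ℕ→ℚ m = + m / 1

sumℚ : ∀ {n} → (Fin n → ℚ) → ℚ
sumℚ {zero}  f = 0ℚ
sumℚ {suc n} f = f zero + sumℚ (λ i → f (suc i))

IsCurvature : ∀ {n} → (Fin n → Fin n → ℕ) → (Fin n → ℚ) → Set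
IsCurvature {n} d w = ∀ i → sumℚ (λ j → ℕ→ℚ (d i j) * w j) ≡ ℕ→ℚ n

-- Disjoint union of G₁ (vertices i ↑ˡ n₂) and G₂ (vertices n₁ ↑ʳ j),
-- plus the single edge {u ↑ˡ n₂ , n₁ ↑ʳ v}.
bridgeAdj : ∀ {n₁ n₂} → Graph n₁ → Graph n₂ → Fin n₁ → Fin n₂ →
            Fin (n₁ +ℕ n₂) → Fin (n₁ +ℕ n₂) → Set
bridgeAdj {n₁} G₁ G₂ u v x y with splitAt n₁ x | splitAt n₁ y
... | inj₁ a | inj₁ b = Adj G₁ a b
... | inj₂ a | inj₂ b = Adj G₂ a b
... | inj₁ a | inj₂ b = (a ≡ u) × (b ≡ v)
... | inj₂ a | inj₁ b = (b ≡ u) × (a ≡ v)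

bridgeSymm : ∀ {n₁ n₂} (G₁ : Graph n₁) (G₂ : Graph n₂) u v {x y} →
             bridgeAdj G₁ G₂ u v x y → bridgeAdj G₁ G₂ u v y x
bridgeSymm {n₁} G₁ G₂ u v {x} {y} p with splitAt n₁ x | splitAt n₁ y
... | inj₁ a | inj₁ b = symm G₁ p
... | inj₂ a | inj₂ b = symm G₂ p
... | inj₁ a | inj₂ b = p
... | inj₂ a | inj₁ b = p

bridgeIrrefl : ∀ {n₁ n₂} (G₁ : Graph n₁) (G₂ : Graph n₂) u v {x} →
               ¬ bridgeAdj G₁ G₂ u v x x
bridgeIrrefl {n₁} G₁ G₂ u v {x} p with splitAt n₁ x
... | inj₁ a = irrefl G₁ p
... | inj₂ a = irrefl G₂ p

bridge : ∀ {n₁ n₂} → Graph n₁ → Graph n₂ → Fin n₁ → Fin n₂ → Graph (n₁ +ℕ n₂)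
bridge G₁ G₂ u v = record
  { Adj = bridgeAdj G₁ G₂ u v
  ; symm = bridgeSymm G₁ G₂ u v
  ; irrefl = bridgeIrrefl G₁ G₂ u v }

{-# OPTIONS --safe #-}
-- Write S₁ = Σ w₁, S₂ = Σ w₂ and δ for the Kronecker delta. Against every row
-- of the distance matrix of G, the vector W = (2 S₂ w₁ − S₁ S₂ δ_u , 2 S₁ w₂ − S₁ S₂ δ_v) has
-- the same sum K = 2 n₁ S₂ + 2 n₂ S₁ + S₁ S₂: a vertex of G₁ at distance q from u is at distance
-- q + 1 + D₂ v b from b ∈ G₂, and the terms in q cancel because −S₁ S₂ δ_u contributes −S₁ S₂ q
-- while the G₂-part of W has total S₁ S₂. Hence (n₁ + n₂) / K · W is a curvature of G.
-- Away from u and v it is nonnegative because w₁, w₂ are. At u it is nonpositive because every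
-- nonnegative curvature satisfies 2 w(u) ≤ Σ w: passing from u to a neighbour changes each
-- distance by at most one and the distance to u by exactly one, so comparing the two rows of
-- D w = n 𝟏 gives n + 2 w(u) ≤ n + Σ w. Finally S₁, S₂ > 0, so K > 0.
module Submission where

open import Defs
open import Data.Nat using (ℕ) renaming (_+_ to _+ℕ_)
open import Data.Fin using (Fin; _↑ˡ_; _↑ʳ_)
open import Data.Rational using (ℚ; 0ℚ; _≤_)
open import Data.Product using (Σ; ∃; _×_; _,_)
open import Relation.Binary.PropositionalEquality using (_≡_)
open import Relation.Nullary using (¬_)

open import Algebra.Bundles using (CommutativeMonoid)
import Algebra.Properties.CommutativeSemigroup as CommutativeSemigroupProperties
open import Data.Bool.Base using (if_then_else_)
open import Data.Fin.Base using (zero; suc; splitAt; join)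
open import Data.Fin.Properties
  using (_≟_; any?; suc-injective; nonZeroIndex; splitAt-↑ˡ; splitAt-↑ʳ; splitAt-join; join-splitAt)
open import Data.Integer.Base as ℤ using (+≤+)
import Data.Integer.Properties as ℤ
open import Data.Nat.Base as ℕ using (zero; suc; z≤n; s≤s)
import Data.Nat.Properties as ℕ
open import Data.Nat.Coprimality as Coprime using (1-coprimeTo)
open import Data.Product.Base using (proj₁; proj₂)
open import Data.Rational.Base
open import Data.Rational.Properties
  using ( normalize-coprime; ≤-refl; ≤-trans; ≤-antisym; <⇒≤; ≰⇒>
        ; +-comm; +-assoc; +-identityˡ; +-identityʳ; +-inverseʳ
        ; +-mono-≤; +-monoˡ-≤; +-monoʳ-≤; +-mono-≤-<; +-0-commutativeMonoid
        ; *-assoc; *-identityˡ; *-identityʳ; *-zeroˡ; *-zeroʳ; *-distribˡ-+; *-distribʳ-+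
        ; *-inverseˡ; neg-distribˡ-*; *-monoʳ-≤-nonNeg; *-1-commutativeMonoid
        ; nonNeg*nonNeg⇒nonNeg; nonNeg*nonPos⇒nonPos; pos*pos⇒pos; pos⇒nonZero; 1/pos⇒pos
        ; positive⁻¹; nonNegative⁻¹; nonPositive⁻¹; module ≤-Reasoning)
open import Data.Rational.Solver using (module +-*-Solver)
open import Data.Sum.Base using (_⊎_; inj₁; inj₂; [_,_]′)
open import Data.Vec.Functional using (_++_)
open import Function.Base using (_∘_)
open import Relation.Binary.PropositionalEquality
  using (refl; sym; trans; cong; cong₂; subst; subst₂; _≢_; module ≡-Reasoning)
open import Relation.Nullary using (yes; no; ¬?; contradiction)
open import Relation.Nullary.Decidable using (does; dec-true; dec-false; decidable-stable)

open +-*-Solver using (solve; _:=_; con; _:+_; _:-_; _:*_; :-_)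
open CommutativeSemigroupProperties (CommutativeMonoid.commutativeSemigroup +-0-commutativeMonoid)
  using (interchange)
open CommutativeSemigroupProperties (CommutativeMonoid.commutativeSemigroup *-1-commutativeMonoid)
  using (x∙yz≈y∙xz)

2ℚ : ℚ
2ℚ = 1ℚ + 1ℚ

ℕ→ℚ≡mkℚ : ∀ m → ℕ→ℚ m ≡ mkℚ (ℤ.+ m) 0 (Coprime.sym (1-coprimeTo m))
ℕ→ℚ≡mkℚ m = normalize-coprime (Coprime.sym (1-coprimeTo m))

ℕ→ℚ-+ : ∀ m n → ℕ→ℚ (m +ℕ n) ≡ ℕ→ℚ m + ℕ→ℚ n
ℕ→ℚ-+ m n = begin
  ℕ→ℚ (m +ℕ n)                              ≡⟨ cong (_/ 1) numerator ⟩
  (ℤ.+ m ℤ.* ℤ.+ 1 ℤ.+ ℤ.+ n ℤ.* ℤ.+ 1) / 1  ≡⟨ cong₂ _+_ (ℕ→ℚ≡mkℚ m) (ℕ→ℚ≡mkℚ n) ⟨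
  ℕ→ℚ m + ℕ→ℚ n                             ∎
  where
  open ≡-Reasoning
  numerator : ℤ.+ (m +ℕ n) ≡ ℤ.+ m ℤ.* ℤ.+ 1 ℤ.+ ℤ.+ n ℤ.* ℤ.+ 1
  numerator = trans (ℤ.pos-+ m n) (sym (cong₂ ℤ._+_ (ℤ.*-identityʳ (ℤ.+ m)) (ℤ.*-identityʳ (ℤ.+ n))))

ℕ→ℚ-+-suc : ∀ m n → ℕ→ℚ (m +ℕ suc n) ≡ 1ℚ + ℕ→ℚ m + ℕ→ℚ n
ℕ→ℚ-+-suc m n = begin
  ℕ→ℚ (m +ℕ suc n)      ≡⟨ cong ℕ→ℚ (ℕ.+-suc m n) ⟩
  ℕ→ℚ (suc m +ℕ n)      ≡⟨ ℕ→ℚ-+ (suc m) n ⟩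
  ℕ→ℚ (suc m) + ℕ→ℚ n   ≡⟨ cong (_+ ℕ→ℚ n) (ℕ→ℚ-+ 1 m) ⟩
  1ℚ + ℕ→ℚ m + ℕ→ℚ n    ∎
  where open ≡-Reasoning

ℕ→ℚ-mono-≤ : ∀ {m n} → m ℕ.≤ n → ℕ→ℚ m ≤ ℕ→ℚ n
ℕ→ℚ-mono-≤ {m} {n} m≤n = subst₂ _≤_ (sym (ℕ→ℚ≡mkℚ m)) (sym (ℕ→ℚ≡mkℚ n))
  (*≤* (subst₂ ℤ._≤_ (sym (ℤ.*-identityʳ (ℤ.+ m))) (sym (ℤ.*-identityʳ (ℤ.+ n))) (+≤+ m≤n)))

ℕ→ℚ-nonNeg : ∀ m → 0ℚ ≤ ℕ→ℚ m
ℕ→ℚ-nonNeg m = ℕ→ℚ-mono-≤ {0} {m} z≤n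

0≤2ℚ : 0ℚ ≤ 2ℚ
0≤2ℚ = +-mono-≤ (ℕ→ℚ-nonNeg 1) (ℕ→ℚ-nonNeg 1)

ℕ→ℚ-nonZero : ∀ n .{{_ : ℕ.NonZero n}} → ℕ→ℚ n ≢ 0ℚ
ℕ→ℚ-nonZero (suc m) eq with trans (sym (ℕ→ℚ≡mkℚ (suc m))) eq
... | ()

*-nonNeg : ∀ {p q} → 0ℚ ≤ p → 0ℚ ≤ q → 0ℚ ≤ p * q
*-nonNeg {p} {q} p≥0 q≥0 =
  nonNegative⁻¹ (p * q) {{nonNeg*nonNeg⇒nonNeg p {{nonNegative p≥0}} q {{nonNegative q≥0}}}}

*-nonNeg-nonPos : ∀ {p q} → 0ℚ ≤ p → q ≤ 0ℚ → p * q ≤ 0ℚ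
*-nonNeg-nonPos {p} {q} p≥0 q≤0 =
  nonPositive⁻¹ (p * q) {{nonNeg*nonPos⇒nonPos p {{nonNegative p≥0}} q {{nonPositive q≤0}}}}

*-pos : ∀ {p q} → 0ℚ < p → 0ℚ < q → 0ℚ < p * q
*-pos {p} {q} p>0 q>0 = positive⁻¹ (p * q) {{pos*pos⇒pos p {{positive p>0}} q {{positive q>0}}}}

+-cancelˡ-≤ : ∀ r {p q} → r + p ≤ r + q → p ≤ q
+-cancelˡ-≤ r {p} {q} r+p≤r+q = begin
  p           ≡⟨ cancel r p ⟨
  r + p - r   ≤⟨ +-monoˡ-≤ (- r) r+p≤r+q ⟩
  r + q - r   ≡⟨ cancel r q ⟩
  q           ∎
  where
  open ≤-Reasoning
  cancel : ∀ r p → r + p - r ≡ p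
  cancel = solve 2 (λ r p → r :+ p :- r := p) refl

sumℚ-cong : ∀ {n} {f g : Fin n → ℚ} → (∀ i → f i ≡ g i) → sumℚ f ≡ sumℚ g
sumℚ-cong {zero}  f≗g = refl
sumℚ-cong {suc n} f≗g = cong₂ _+_ (f≗g zero) (sumℚ-cong (f≗g ∘ suc))

sumℚ-+ : ∀ {n} (f g : Fin n → ℚ) → sumℚ (λ i → f i + g i) ≡ sumℚ f + sumℚ g
sumℚ-+ {zero}  f g = refl
sumℚ-+ {suc n} f g = trans (cong (f zero + g zero +_) (sumℚ-+ (f ∘ suc) (g ∘ suc)))
                           (interchange (f zero) (g zero) (sumℚ (f ∘ suc)) (sumℚ (g ∘ suc)))

sumℚ-*ˡ : ∀ {n} c (f : Fin n → ℚ) → sumℚ (λ i → c * f i) ≡ c * sumℚ f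
sumℚ-*ˡ {zero}  c f = sym (*-zeroʳ c)
sumℚ-*ˡ {suc n} c f =
  trans (cong (c * f zero +_) (sumℚ-*ˡ c (f ∘ suc))) (sym (*-distribˡ-+ c (f zero) (sumℚ (f ∘ suc))))

sumℚ-*-distribʳ-+ : ∀ {n} (a b w : Fin n → ℚ) →
  sumℚ (λ i → (a i + b i) * w i) ≡ sumℚ (λ i → a i * w i) + sumℚ (λ i → b i * w i)
sumℚ-*-distribʳ-+ a b w = trans (sumℚ-cong (λ i → *-distribʳ-+ (w i) (a i) (b i)))
                                (sumℚ-+ (λ i → a i * w i) (λ i → b i * w i))

sumℚ-↑ : ∀ m n (f : Fin (m +ℕ n) → ℚ) →
  sumℚ f ≡ sumℚ (λ i → f (i ↑ˡ n)) + sumℚ (λ j → f (m ↑ʳ j))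
sumℚ-↑ zero    n f = sym (+-identityˡ (sumℚ f))
sumℚ-↑ (suc m) n f = trans (cong (f zero +_) (sumℚ-↑ m n (f ∘ suc)))
  (sym (+-assoc (f zero) (sumℚ (λ i → f (suc (i ↑ˡ n)))) (sumℚ (λ j → f (suc (m ↑ʳ j))))))

↑-elim : ∀ {m n} {P : Fin (m +ℕ n) → Set} →
  (∀ i → P (i ↑ˡ n)) → (∀ j → P (m ↑ʳ j)) → ∀ x → P x
↑-elim {zero}  left right x       = right x
↑-elim {suc m} left right zero    = left zero
↑-elim {suc m} left right (suc x) = ↑-elim (left ∘ suc) right x

sumℚ-zero : ∀ {n} {f : Fin n → ℚ} → (∀ i → f i ≡ 0ℚ) → sumℚ f ≡ 0ℚ
sumℚ-zero {zero}  f≗0 = refl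
sumℚ-zero {suc n} f≗0 = cong₂ _+_ (f≗0 zero) (sumℚ-zero (f≗0 ∘ suc))

sumℚ-supported : ∀ {n} (f : Fin n → ℚ) u → (∀ j → j ≢ u → f j ≡ 0ℚ) → sumℚ f ≡ f u
sumℚ-supported f zero    f≗0 =
  trans (cong (f zero +_) (sumℚ-zero (λ i → f≗0 (suc i) λ ()))) (+-identityʳ (f zero))
sumℚ-supported f (suc u) f≗0 =
  trans (cong₂ _+_ (f≗0 zero λ ())
                   (sumℚ-supported (f ∘ suc) u (λ i i≢u → f≗0 (suc i) (i≢u ∘ suc-injective))))
        (+-identityˡ (f (suc u)))

sumℚ-nonNeg : ∀ {n} {f : Fin n → ℚ} → (∀ i → 0ℚ ≤ f i) → 0ℚ ≤ sumℚ f
sumℚ-nonNeg {zero}  f≥0 = ≤-refl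
sumℚ-nonNeg {suc n} f≥0 = +-mono-≤ (f≥0 zero) (sumℚ-nonNeg (f≥0 ∘ suc))

sumℚ-mono-≤ : ∀ {n} {f g : Fin n → ℚ} → (∀ i → f i ≤ g i) → sumℚ f ≤ sumℚ g
sumℚ-mono-≤ {zero}  f≤g = ≤-refl
sumℚ-mono-≤ {suc n} f≤g = +-mono-≤ (f≤g zero) (sumℚ-mono-≤ (f≤g ∘ suc))

term≤sumℚ : ∀ {n} {f : Fin n → ℚ} → (∀ i → 0ℚ ≤ f i) → ∀ i → f i ≤ sumℚ f
term≤sumℚ {suc n} {f} f≥0 zero = begin
  f zero                ≡⟨ +-identityʳ (f zero) ⟨
  f zero + 0ℚ           ≤⟨ +-monoʳ-≤ (f zero) (sumℚ-nonNeg (f≥0 ∘ suc)) ⟩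
  sumℚ f                ∎
  where open ≤-Reasoning
term≤sumℚ {suc n} {f} f≥0 (suc i) = begin
  f (suc i)             ≤⟨ term≤sumℚ (f≥0 ∘ suc) i ⟩
  sumℚ (f ∘ suc)        ≡⟨ +-identityˡ (sumℚ (f ∘ suc)) ⟨
  0ℚ + sumℚ (f ∘ suc)   ≤⟨ +-monoˡ-≤ (sumℚ (f ∘ suc)) (f≥0 zero) ⟩
  sumℚ f                ∎
  where open ≤-Reasoning

δ : ∀ {n} → Fin n → Fin n → ℚ
δ u j = if does (j ≟ u) then 1ℚ else 0ℚ

δ-same : ∀ {n} (u : Fin n) → δ u u ≡ 1ℚ
δ-same u = cong (if_then 1ℚ else 0ℚ) (dec-true (u ≟ u) refl)

δ-other : ∀ {n} {u j : Fin n} → j ≢ u → δ u j ≡ 0ℚ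
δ-other {u = u} {j} j≢u = cong (if_then 1ℚ else 0ℚ) (dec-false (j ≟ u) j≢u)

sumℚ-δ* : ∀ {n} (f : Fin n → ℚ) u → sumℚ (λ j → δ u j * f j) ≡ f u
sumℚ-δ* f u = begin
  sumℚ (λ j → δ u j * f j)  ≡⟨ sumℚ-supported _ u off-u ⟩
  δ u u * f u               ≡⟨ cong (_* f u) (δ-same u) ⟩
  1ℚ * f u                  ≡⟨ *-identityˡ (f u) ⟩
  f u                       ∎
  where
  open ≡-Reasoning
  off-u : ∀ j → j ≢ u → δ u j * f j ≡ 0ℚ
  off-u j j≢u = trans (cong (_* f j) (δ-other j≢u)) (*-zeroˡ (f j))

module _ {n} {G : Graph n} where

  _++ʷ_ : ∀ {x y z l m} → Walk G x y l → Walk G y z m → Walk G x z (l +ℕ m)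
  nil      ++ʷ q = q
  cons e p ++ʷ q = cons e (p ++ʷ q)

  walk-length-pos : ∀ {x y l} → x ≢ y → Walk G x y l → 0 ℕ.< l
  walk-length-pos x≢y nil        = contradiction refl x≢y
  walk-length-pos x≢y (cons _ _) = s≤s z≤n

  walk-first-edge : ∀ {x y l} → x ≢ y → Walk G x y l → ∃ (Adj G x)
  walk-first-edge x≢y nil        = contradiction refl x≢y
  walk-first-edge x≢y (cons e _) = _ , e

module Distance {n} {G : Graph n} {D : Fin n → Fin n → ℕ} (isD : IsDistanceMatrix G D) where

  shortest : ∀ x y → Walk G x y (D x y)
  shortest x y = proj₁ (isD x y)

  shortest-minimal : ∀ {x y l} → Walk G x y l → D x y ℕ.≤ l
  shortest-minimal {x} {y} {l} = proj₂ (isD x y) l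

  dist-self : ∀ x → D x x ≡ 0
  dist-self x = ℕ.n≤0⇒n≡0 (shortest-minimal nil)

  dist-pos : ∀ {x y} → x ≢ y → 0 ℕ.< D x y
  dist-pos {x} {y} x≢y = walk-length-pos x≢y (shortest x y)

  dist-adj : ∀ {x y} z → Adj G x y → D x z ℕ.≤ suc (D y z)
  dist-adj z e = shortest-minimal (cons e (shortest _ z))

  -- d (-) z drops by at most one along each edge, so it bounds from below
  -- the length of every walk ending at z.
  distance-unique : (d : Fin n → Fin n → ℕ) →
    (∀ x y → Walk G x y (d x y)) → (∀ x → d x x ≡ 0) →
    (∀ {x y} z → Adj G x y → d x z ℕ.≤ suc (d y z)) →
    ∀ x y → D x y ≡ d x y
  distance-unique d walk self step x y =
    ℕ.≤-antisym (shortest-minimal (walk x y)) (lower (shortest x y))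
    where
    lower : ∀ {x l} → Walk G x y l → d x y ℕ.≤ l
    lower nil        = ℕ.≤-reflexive (self y)
    lower (cons e p) = ℕ.≤-trans (step y e) (s≤s (lower p))

module BridgeDistance {n₁ n₂} {G₁ : Graph n₁} {G₂ : Graph n₂} (u : Fin n₁) (v : Fin n₂)
  {D₁ : Fin n₁ → Fin n₁ → ℕ} (isD₁ : IsDistanceMatrix G₁ D₁)
  {D₂ : Fin n₂ → Fin n₂ → ℕ} (isD₂ : IsDistanceMatrix G₂ D₂) where

  private
    module D₁ = Distance isD₁
    module D₂ = Distance isD₂

  B : Graph (n₁ +ℕ n₂)
  B = bridge G₁ G₂ u v

  bridgeDist : Fin n₁ ⊎ Fin n₂ → Fin n₁ ⊎ Fin n₂ → ℕ
  bridgeDist (inj₁ a) (inj₁ b) = D₁ a b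
  bridgeDist (inj₁ a) (inj₂ b) = D₁ a u +ℕ suc (D₂ v b)
  bridgeDist (inj₂ a) (inj₁ b) = D₂ a v +ℕ suc (D₁ u b)
  bridgeDist (inj₂ a) (inj₂ b) = D₂ a b

  adj-↑ˡ : ∀ {a b} → Adj G₁ a b → Adj B (a ↑ˡ n₂) (b ↑ˡ n₂)
  adj-↑ˡ {a} {b} e rewrite splitAt-↑ˡ n₁ a n₂ | splitAt-↑ˡ n₁ b n₂ = e

  adj-↑ʳ : ∀ {a b} → Adj G₂ a b → Adj B (n₁ ↑ʳ a) (n₁ ↑ʳ b)
  adj-↑ʳ {a} {b} e rewrite splitAt-↑ʳ n₁ n₂ a | splitAt-↑ʳ n₁ n₂ b = e

  adj-bridge : Adj B (u ↑ˡ n₂) (n₁ ↑ʳ v)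
  adj-bridge rewrite splitAt-↑ˡ n₁ u n₂ | splitAt-↑ʳ n₁ n₂ v = refl , refl

  walk-↑ˡ : ∀ {a b l} → Walk G₁ a b l → Walk B (a ↑ˡ n₂) (b ↑ˡ n₂) l
  walk-↑ˡ nil        = nil
  walk-↑ˡ (cons e p) = cons (adj-↑ˡ e) (walk-↑ˡ p)

  walk-↑ʳ : ∀ {a b l} → Walk G₂ a b l → Walk B (n₁ ↑ʳ a) (n₁ ↑ʳ b) l
  walk-↑ʳ nil        = nil
  walk-↑ʳ (cons e p) = cons (adj-↑ʳ e) (walk-↑ʳ p)

  bridgeDist-walk : ∀ s t → Walk B (join n₁ n₂ s) (join n₁ n₂ t) (bridgeDist s t)
  bridgeDist-walk (inj₁ a) (inj₁ b) = walk-↑ˡ (D₁.shortest a b)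
  bridgeDist-walk (inj₁ a) (inj₂ b) =
    walk-↑ˡ (D₁.shortest a u) ++ʷ cons adj-bridge (walk-↑ʳ (D₂.shortest v b))
  bridgeDist-walk (inj₂ a) (inj₁ b) =
    walk-↑ʳ (D₂.shortest a v) ++ʷ cons (symm B adj-bridge) (walk-↑ˡ (D₁.shortest u b))
  bridgeDist-walk (inj₂ a) (inj₂ b) = walk-↑ʳ (D₂.shortest a b)

  bridgeDist-self : ∀ s → bridgeDist s s ≡ 0
  bridgeDist-self (inj₁ a) = D₁.dist-self a
  bridgeDist-self (inj₂ b) = D₂.dist-self b

  private
    detour : ∀ k m → m ℕ.≤ suc (k +ℕ suc m)
    detour k m = ℕ.≤-trans (ℕ.n≤1+n m) (ℕ.m≤n+m (suc m) (suc k))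

  bridgeDist-adj : ∀ {x y} t → Adj B x y →
    bridgeDist (splitAt n₁ x) t ℕ.≤ suc (bridgeDist (splitAt n₁ y) t)
  bridgeDist-adj {x} {y} t e with splitAt n₁ x | splitAt n₁ y
  bridgeDist-adj (inj₁ c) e             | inj₁ a | inj₁ b = D₁.dist-adj c e
  bridgeDist-adj (inj₂ c) e             | inj₁ a | inj₁ b = ℕ.+-monoˡ-≤ _ (D₁.dist-adj u e)
  bridgeDist-adj (inj₁ c) e             | inj₂ a | inj₂ b = ℕ.+-monoˡ-≤ _ (D₂.dist-adj v e)
  bridgeDist-adj (inj₂ c) e             | inj₂ a | inj₂ b = D₂.dist-adj c e
  bridgeDist-adj (inj₁ c) (refl , refl) | inj₁ _ | inj₂ _ = detour (D₂ v v) (D₁ u c)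
  bridgeDist-adj (inj₂ c) (refl , refl) | inj₁ _ | inj₂ _ =
    ℕ.≤-reflexive (cong (ℕ._+ suc (D₂ v c)) (D₁.dist-self u))
  bridgeDist-adj (inj₁ c) (refl , refl) | inj₂ _ | inj₁ _ =
    ℕ.≤-reflexive (cong (ℕ._+ suc (D₁ u c)) (D₂.dist-self v))
  bridgeDist-adj (inj₂ c) (refl , refl) | inj₂ _ | inj₁ _ = detour (D₁ u u) (D₂ v c)

  bridge-distance : ∀ {D} → IsDistanceMatrix B D →
    ∀ s t → D (join n₁ n₂ s) (join n₁ n₂ t) ≡ bridgeDist s t
  bridge-distance {D} isD s t = begin
    D (join n₁ n₂ s) (join n₁ n₂ t)
      ≡⟨ Distance.distance-unique isD d walk self step _ _ ⟩
    d (join n₁ n₂ s) (join n₁ n₂ t)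
      ≡⟨ cong₂ bridgeDist (splitAt-join n₁ n₂ s) (splitAt-join n₁ n₂ t) ⟩
    bridgeDist s t
      ∎
    where
    open ≡-Reasoning
    d : Fin (n₁ +ℕ n₂) → Fin (n₁ +ℕ n₂) → ℕ
    d x y = bridgeDist (splitAt n₁ x) (splitAt n₁ y)
    walk : ∀ x y → Walk B x y (d x y)
    walk x y = subst₂ (λ x′ y′ → Walk B x′ y′ (d x y))
                      (join-splitAt n₁ n₂ x) (join-splitAt n₁ n₂ y)
                      (bridgeDist-walk (splitAt n₁ x) (splitAt n₁ y))
    self : ∀ x → d x x ≡ 0
    self x = bridgeDist-self (splitAt n₁ x)
    step : ∀ {x y} z → Adj B x y → d x z ℕ.≤ suc (d y z)
    step z = bridgeDist-adj (splitAt n₁ z)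

module NonNegativeCurvature {n} {G : Graph n} {D : Fin n → Fin n → ℕ} (isD : IsDistanceMatrix G D)
  {w : Fin n → ℚ} (cw : IsCurvature D w) (w≥0 : ∀ i → 0ℚ ≤ w i) where

  open Distance isD

  row-nonvanishing : ∀ u → ¬ (∀ j → ℕ→ℚ (D u j) * w j ≡ 0ℚ)
  row-nonvanishing u row≡0 = ℕ→ℚ-nonZero n {{nonZeroIndex u}} (trans (sym (cw u)) (sumℚ-zero row≡0))

  neighbour : ∀ u → ∃ (Adj G u)
  neighbour u with any? (λ x → ¬? (x ≟ u))
  ... | yes (x , x≢u) = walk-first-edge (x≢u ∘ sym) (shortest u x)
  ... | no ∄x≢u       = contradiction row≡0 (row-nonvanishing u)
    where
    row≡0 : ∀ j → ℕ→ℚ (D u j) * w j ≡ 0ℚ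
    row≡0 j with decidable-stable (j ≟ u) (λ j≢u → ∄x≢u (j , j≢u))
    ... | refl = trans (cong (λ d → ℕ→ℚ d * w j) (dist-self j)) (*-zeroˡ (w j))

  coefficient-bound : ∀ {u y} → Adj G u y →
    ∀ j → ℕ→ℚ (D u j) + δ u j * 2ℚ ≤ 1ℚ + ℕ→ℚ (D y j)
  coefficient-bound {u} {y} u~y j with j ≟ u
  ... | yes refl = begin
    ℕ→ℚ (D j j) + 1ℚ * 2ℚ   ≡⟨ cong (λ d → ℕ→ℚ d + 1ℚ * 2ℚ) (dist-self j) ⟩
    0ℚ + 1ℚ * 2ℚ            ≡⟨ trans (+-identityˡ (1ℚ * 2ℚ)) (*-identityˡ 2ℚ) ⟩
    2ℚ                     ≡⟨ ℕ→ℚ-+ 1 1 ⟨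
    ℕ→ℚ 2                  ≤⟨ ℕ→ℚ-mono-≤ {2} {suc (D y j)} (s≤s (dist-pos y≢j)) ⟩
    ℕ→ℚ (suc (D y j))      ≡⟨ ℕ→ℚ-+ 1 (D y j) ⟩
    1ℚ + ℕ→ℚ (D y j)       ∎
    where
    open ≤-Reasoning
    y≢j : y ≢ j
    y≢j y≡j = irrefl G (subst (Adj G j) y≡j u~y)
  ... | no _ = begin
    ℕ→ℚ (D u j) + 0ℚ * 2ℚ  ≡⟨ cong (ℕ→ℚ (D u j) +_) (*-zeroˡ 2ℚ) ⟩
    ℕ→ℚ (D u j) + 0ℚ       ≡⟨ +-identityʳ (ℕ→ℚ (D u j)) ⟩
    ℕ→ℚ (D u j)            ≤⟨ ℕ→ℚ-mono-≤ {D u j} {suc (D y j)} (dist-adj j u~y) ⟩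
    ℕ→ℚ (suc (D y j))      ≡⟨ ℕ→ℚ-+ 1 (D y j) ⟩
    1ℚ + ℕ→ℚ (D y j)       ∎
    where open ≤-Reasoning

  twice-weight≤total : ∀ u → 2ℚ * w u ≤ sumℚ w
  twice-weight≤total u = compare-rows (proj₂ (neighbour u))
    where
    compare-rows : ∀ {y} → Adj G u y → 2ℚ * w u ≤ sumℚ w
    compare-rows {y} u~y = +-cancelˡ-≤ (ℕ→ℚ n) (begin
      ℕ→ℚ n + 2ℚ * w u                                ≡⟨ row-u ⟨
      sumℚ (λ j → (ℕ→ℚ (D u j) + δ u j * 2ℚ) * w j)  ≤⟨ sumℚ-mono-≤ termwise ⟩
      sumℚ (λ j → (1ℚ + ℕ→ℚ (D y j)) * w j)           ≡⟨ row-y ⟩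
      ℕ→ℚ n + sumℚ w                                  ∎)
      where
      open ≤-Reasoning
      row-u : sumℚ (λ j → (ℕ→ℚ (D u j) + δ u j * 2ℚ) * w j) ≡ ℕ→ℚ n + 2ℚ * w u
      row-u = trans (sumℚ-*-distribʳ-+ (ℕ→ℚ ∘ D u) (λ j → δ u j * 2ℚ) w)
        (cong₂ _+_ (cw u) (trans (sumℚ-cong (λ j → *-assoc (δ u j) 2ℚ (w j)))
                                 (sumℚ-δ* (λ j → 2ℚ * w j) u)))
      row-y : sumℚ (λ j → (1ℚ + ℕ→ℚ (D y j)) * w j) ≡ ℕ→ℚ n + sumℚ w
      row-y = trans (sumℚ-*-distribʳ-+ (λ _ → 1ℚ) (ℕ→ℚ ∘ D y) w)
        (trans (cong₂ _+_ (trans (sumℚ-*ˡ 1ℚ w) (*-identityˡ (sumℚ w))) (cw y))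
               (+-comm (sumℚ w) (ℕ→ℚ n)))
      termwise : ∀ j → (ℕ→ℚ (D u j) + δ u j * 2ℚ) * w j ≤ (1ℚ + ℕ→ℚ (D y j)) * w j
      termwise j = *-monoʳ-≤-nonNeg (w j) {{nonNegative (w≥0 j)}} (coefficient-bound u~y j)

  corrected-self≤0 : ∀ u {S′} → 0ℚ ≤ S′ → 2ℚ * S′ * w u - sumℚ w * S′ ≤ 0ℚ
  corrected-self≤0 u {S′} S′≥0 = begin
    2ℚ * S′ * w u - sumℚ w * S′   ≡⟨ factor (w u) (sumℚ w) S′ ⟩
    (2ℚ * w u - sumℚ w) * S′      ≤⟨ *-monoʳ-≤-nonNeg S′ {{nonNegative S′≥0}}
                                       (+-monoˡ-≤ (- sumℚ w) (twice-weight≤total u)) ⟩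
    (sumℚ w - sumℚ w) * S′        ≡⟨ cong (_* S′) (+-inverseʳ (sumℚ w)) ⟩
    0ℚ * S′                       ≡⟨ *-zeroˡ S′ ⟩
    0ℚ                            ∎
    where
    open ≤-Reasoning
    factor : ∀ x S S′ → 2ℚ * S′ * x - S * S′ ≡ (2ℚ * x - S) * S′
    factor = solve 3 (λ x S S′ → con 2ℚ :* S′ :* x :- S :* S′ := (con 2ℚ :* x :- S) :* S′) refl

  total-pos : Fin n → 0ℚ < sumℚ w
  total-pos u = ≰⇒> λ total≤0 → row-nonvanishing u λ j →
    trans (cong (ℕ→ℚ (D u j) *_) (≤-antisym (≤-trans (term≤sumℚ w≥0 j) total≤0) (w≥0 j)))
          (*-zeroʳ (ℕ→ℚ (D u j)))

module CorrectedAt {n} {G : Graph n} {D : Fin n → Fin n → ℕ} (isD : IsDistanceMatrix G D)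
  {w : Fin n → ℚ} (cw : IsCurvature D w) (u : Fin n) (α β : ℚ) where

  W : Fin n → ℚ
  W j = α * w j - β * δ u j

  W-self : W u ≡ α * w u - β
  W-self = cong (λ d → α * w u - d) (trans (cong (β *_) (δ-same u)) (*-identityʳ β))

  W-other : ∀ {j} → j ≢ u → W j ≡ α * w j
  W-other {j} j≢u = trans (cong (λ d → α * w j - d) (trans (cong (β *_) (δ-other j≢u)) (*-zeroʳ β)))
                          (+-identityʳ (α * w j))

  W-other≥0 : 0ℚ ≤ α → (∀ i → 0ℚ ≤ w i) → ∀ {j} → j ≢ u → 0ℚ ≤ W j
  W-other≥0 α≥0 w≥0 {j} j≢u = subst (0ℚ ≤_) (sym (W-other j≢u)) (*-nonNeg α≥0 (w≥0 j))

  sumℚ-*W : ∀ (c : Fin n → ℚ) → sumℚ (λ j → c j * W j) ≡ α * sumℚ (λ j → c j * w j) - β * c u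
  sumℚ-*W c = begin
    sumℚ (λ j → c j * W j)
      ≡⟨ sumℚ-cong (λ j → expand α β (c j) (w j) (δ u j)) ⟩
    sumℚ (λ j → α * (c j * w j) + - β * (δ u j * c j))
      ≡⟨ sumℚ-+ (λ j → α * (c j * w j)) (λ j → - β * (δ u j * c j)) ⟩
    sumℚ (λ j → α * (c j * w j)) + sumℚ (λ j → - β * (δ u j * c j))
      ≡⟨ cong₂ _+_ (sumℚ-*ˡ α (λ j → c j * w j)) (sumℚ-*ˡ (- β) (λ j → δ u j * c j)) ⟩
    α * sumℚ (λ j → c j * w j) + - β * sumℚ (λ j → δ u j * c j)
      ≡⟨ cong (λ s → α * sumℚ (λ j → c j * w j) + - β * s) (sumℚ-δ* c u) ⟩
    α * sumℚ (λ j → c j * w j) + - β * c u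
      ≡⟨ cong (α * sumℚ (λ j → c j * w j) +_) (neg-distribˡ-* β (c u)) ⟨
    α * sumℚ (λ j → c j * w j) - β * c u
      ∎
    where
    open ≡-Reasoning
    expand : ∀ α β c x d → c * (α * x - β * d) ≡ α * (c * x) + - β * (d * c)
    expand = solve 5 (λ α β c x d → c :* (α :* x :- β :* d) := α :* (c :* x) :+ (:- β) :* (d :* c)) refl

  row-near : ∀ a → sumℚ (λ j → ℕ→ℚ (D a j) * W j) ≡ α * ℕ→ℚ n - β * ℕ→ℚ (D a u)
  row-near a = trans (sumℚ-*W (ℕ→ℚ ∘ D a)) (cong (λ s → α * s - β * ℕ→ℚ (D a u)) (cw a))

  -- The row of a vertex at distance c from u that reaches this graph only through u.
  row-far : ∀ c → sumℚ (λ j → (c + ℕ→ℚ (D u j)) * W j) ≡ α * (c * sumℚ w + ℕ→ℚ n) - β * c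
  row-far c = begin
    sumℚ (λ j → (c + ℕ→ℚ (D u j)) * W j)
      ≡⟨ sumℚ-*W (λ j → c + ℕ→ℚ (D u j)) ⟩
    α * sumℚ (λ j → (c + ℕ→ℚ (D u j)) * w j) - β * (c + ℕ→ℚ (D u u))
      ≡⟨ cong₂ (λ s d → α * s - β * d) (sumℚ-*-distribʳ-+ (λ _ → c) (ℕ→ℚ ∘ D u) w)
                                       (cong (λ d → c + ℕ→ℚ d) (Distance.dist-self isD u)) ⟩
    α * (sumℚ (λ j → c * w j) + sumℚ (λ j → ℕ→ℚ (D u j) * w j)) - β * (c + 0ℚ)
      ≡⟨ cong₂ (λ s d → α * s - β * d) (cong₂ _+_ (sumℚ-*ˡ c w) (cw u)) (+-identityʳ c) ⟩
    α * (c * sumℚ w + ℕ→ℚ n) - β * c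
      ∎
    where open ≡-Reasoning

rescale-to-curvature : ∀ {n} {D : Fin n → Fin n → ℕ} {W : Fin n → ℚ} K .{{_ : NonZero K}} →
  (∀ i → sumℚ (λ j → ℕ→ℚ (D i j) * W j) ≡ K) → IsCurvature D (λ j → ℕ→ℚ n * 1/ K * W j)
rescale-to-curvature {n} {D} {W} K rows i = begin
  sumℚ (λ j → ℕ→ℚ (D i j) * (c * W j))  ≡⟨ sumℚ-cong (λ j → x∙yz≈y∙xz (ℕ→ℚ (D i j)) c (W j)) ⟩
  sumℚ (λ j → c * (ℕ→ℚ (D i j) * W j))  ≡⟨ sumℚ-*ˡ c (λ j → ℕ→ℚ (D i j) * W j) ⟩
  c * sumℚ (λ j → ℕ→ℚ (D i j) * W j)    ≡⟨ cong (c *_) (rows i) ⟩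
  ℕ→ℚ n * 1/ K * K                      ≡⟨ *-assoc (ℕ→ℚ n) (1/ K) K ⟩
  ℕ→ℚ n * (1/ K * K)                    ≡⟨ cong (ℕ→ℚ n *_) (*-inverseˡ K) ⟩
  ℕ→ℚ n * 1ℚ                            ≡⟨ *-identityʳ (ℕ→ℚ n) ⟩
  ℕ→ℚ n                                 ∎
  where
  open ≡-Reasoning
  c = ℕ→ℚ n * 1/ K

module BridgeCurvature {n₁ n₂} {G₁ : Graph n₁} {G₂ : Graph n₂}
  {D₁ : Fin n₁ → Fin n₁ → ℕ} (isD₁ : IsDistanceMatrix G₁ D₁)
  {D₂ : Fin n₂ → Fin n₂ → ℕ} (isD₂ : IsDistanceMatrix G₂ D₂)
  {w₁ : Fin n₁ → ℚ} (cw₁ : IsCurvature D₁ w₁) (w₁≥0 : ∀ i → 0ℚ ≤ w₁ i)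
  {w₂ : Fin n₂ → ℚ} (cw₂ : IsCurvature D₂ w₂) (w₂≥0 : ∀ i → 0ℚ ≤ w₂ i)
  (u : Fin n₁) (v : Fin n₂)
  {D : Fin (n₁ +ℕ n₂) → Fin (n₁ +ℕ n₂) → ℕ} (isD : IsDistanceMatrix (bridge G₁ G₂ u v) D) where

  private
    module N₁ = NonNegativeCurvature isD₁ cw₁ w₁≥0
    module N₂ = NonNegativeCurvature isD₂ cw₂ w₂≥0

    dist : ∀ s t → D (join n₁ n₂ s) (join n₁ n₂ t) ≡ BridgeDistance.bridgeDist u v isD₁ isD₂ s t
    dist = BridgeDistance.bridge-distance u v isD₁ isD₂ isD

  S₁ S₂ : ℚ
  S₁ = sumℚ w₁
  S₂ = sumℚ w₂

  S₁≥0 : 0ℚ ≤ S₁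
  S₁≥0 = sumℚ-nonNeg w₁≥0

  S₂≥0 : 0ℚ ≤ S₂
  S₂≥0 = sumℚ-nonNeg w₂≥0

  module C₁ = CorrectedAt isD₁ cw₁ u (2ℚ * S₂) (S₁ * S₂)
  module C₂ = CorrectedAt isD₂ cw₂ v (2ℚ * S₁) (S₂ * S₁)

  W : Fin (n₁ +ℕ n₂) → ℚ
  W = C₁.W ++ C₂.W

  W-↑ˡ : ∀ a → W (a ↑ˡ n₂) ≡ C₁.W a
  W-↑ˡ a = cong [ C₁.W , C₂.W ]′ (splitAt-↑ˡ n₁ a n₂)

  W-↑ʳ : ∀ b → W (n₁ ↑ʳ b) ≡ C₂.W b
  W-↑ʳ b = cong [ C₁.W , C₂.W ]′ (splitAt-↑ʳ n₁ n₂ b)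

  K : ℚ
  K = 2ℚ * S₂ * ℕ→ℚ n₁ + 2ℚ * S₁ * ℕ→ℚ n₂ + S₁ * S₂

  row-split : ∀ x → sumℚ (λ y → ℕ→ℚ (D x y) * W y) ≡
    sumℚ (λ b → ℕ→ℚ (D x (b ↑ˡ n₂)) * C₁.W b) + sumℚ (λ b → ℕ→ℚ (D x (n₁ ↑ʳ b)) * C₂.W b)
  row-split x = trans (sumℚ-↑ n₁ n₂ (λ y → ℕ→ℚ (D x y) * W y))
    (cong₂ _+_ (sumℚ-cong λ b → cong (ℕ→ℚ (D x (b ↑ˡ n₂)) *_) (W-↑ˡ b))
               (sumℚ-cong λ b → cong (ℕ→ℚ (D x (n₁ ↑ʳ b)) *_) (W-↑ʳ b)))

  row-↑ˡ : ∀ a → sumℚ (λ y → ℕ→ℚ (D (a ↑ˡ n₂) y) * W y) ≡ K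
  row-↑ˡ a = begin
    sumℚ (λ y → ℕ→ℚ (D (a ↑ˡ n₂) y) * W y)
      ≡⟨ row-split (a ↑ˡ n₂) ⟩
    sumℚ (λ b → ℕ→ℚ (D (a ↑ˡ n₂) (b ↑ˡ n₂)) * C₁.W b)
      + sumℚ (λ b → ℕ→ℚ (D (a ↑ˡ n₂) (n₁ ↑ʳ b)) * C₂.W b)
      ≡⟨ cong₂ _+_ (sumℚ-cong λ b → cong (λ d → ℕ→ℚ d * C₁.W b) (dist (inj₁ a) (inj₁ b)))
                   (sumℚ-cong λ b → cong (_* C₂.W b)
                     (trans (cong ℕ→ℚ (dist (inj₁ a) (inj₂ b))) (ℕ→ℚ-+-suc (D₁ a u) (D₂ v b)))) ⟩
    sumℚ (λ b → ℕ→ℚ (D₁ a b) * C₁.W b) + sumℚ (λ b → (1ℚ + q + ℕ→ℚ (D₂ v b)) * C₂.W b)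
      ≡⟨ cong₂ _+_ (C₁.row-near a) (C₂.row-far (1ℚ + q)) ⟩
    2ℚ * S₂ * ℕ→ℚ n₁ - S₁ * S₂ * q
      + (2ℚ * S₁ * ((1ℚ + q) * S₂ + ℕ→ℚ n₂) - S₂ * S₁ * (1ℚ + q))
      ≡⟨ identity S₁ S₂ (ℕ→ℚ n₁) (ℕ→ℚ n₂) q ⟩
    K ∎
    where
    open ≡-Reasoning
    q = ℕ→ℚ (D₁ a u)
    identity : ∀ s₁ s₂ m₁ m₂ q →
      2ℚ * s₂ * m₁ - s₁ * s₂ * q + (2ℚ * s₁ * ((1ℚ + q) * s₂ + m₂) - s₂ * s₁ * (1ℚ + q)) ≡
      2ℚ * s₂ * m₁ + 2ℚ * s₁ * m₂ + s₁ * s₂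
    identity = solve 5 (λ s₁ s₂ m₁ m₂ q →
      con 2ℚ :* s₂ :* m₁ :- s₁ :* s₂ :* q
        :+ (con 2ℚ :* s₁ :* ((con 1ℚ :+ q) :* s₂ :+ m₂) :- s₂ :* s₁ :* (con 1ℚ :+ q)) :=
      con 2ℚ :* s₂ :* m₁ :+ con 2ℚ :* s₁ :* m₂ :+ s₁ :* s₂) refl

  row-↑ʳ : ∀ a → sumℚ (λ y → ℕ→ℚ (D (n₁ ↑ʳ a) y) * W y) ≡ K
  row-↑ʳ a = begin
    sumℚ (λ y → ℕ→ℚ (D (n₁ ↑ʳ a) y) * W y)
      ≡⟨ row-split (n₁ ↑ʳ a) ⟩
    sumℚ (λ b → ℕ→ℚ (D (n₁ ↑ʳ a) (b ↑ˡ n₂)) * C₁.W b)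
      + sumℚ (λ b → ℕ→ℚ (D (n₁ ↑ʳ a) (n₁ ↑ʳ b)) * C₂.W b)
      ≡⟨ cong₂ _+_ (sumℚ-cong λ b → cong (_* C₁.W b)
                     (trans (cong ℕ→ℚ (dist (inj₂ a) (inj₁ b))) (ℕ→ℚ-+-suc (D₂ a v) (D₁ u b))))
                   (sumℚ-cong λ b → cong (λ d → ℕ→ℚ d * C₂.W b) (dist (inj₂ a) (inj₂ b))) ⟩
    sumℚ (λ b → (1ℚ + q + ℕ→ℚ (D₁ u b)) * C₁.W b) + sumℚ (λ b → ℕ→ℚ (D₂ a b) * C₂.W b)
      ≡⟨ cong₂ _+_ (C₁.row-far (1ℚ + q)) (C₂.row-near a) ⟩
    2ℚ * S₂ * ((1ℚ + q) * S₁ + ℕ→ℚ n₁) - S₁ * S₂ * (1ℚ + q)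
      + (2ℚ * S₁ * ℕ→ℚ n₂ - S₂ * S₁ * q)
      ≡⟨ identity S₁ S₂ (ℕ→ℚ n₁) (ℕ→ℚ n₂) q ⟩
    K ∎
    where
    open ≡-Reasoning
    q = ℕ→ℚ (D₂ a v)
    identity : ∀ s₁ s₂ m₁ m₂ q →
      2ℚ * s₂ * ((1ℚ + q) * s₁ + m₁) - s₁ * s₂ * (1ℚ + q) + (2ℚ * s₁ * m₂ - s₂ * s₁ * q) ≡
      2ℚ * s₂ * m₁ + 2ℚ * s₁ * m₂ + s₁ * s₂
    identity = solve 5 (λ s₁ s₂ m₁ m₂ q →
      con 2ℚ :* s₂ :* ((con 1ℚ :+ q) :* s₁ :+ m₁) :- s₁ :* s₂ :* (con 1ℚ :+ q)
        :+ (con 2ℚ :* s₁ :* m₂ :- s₂ :* s₁ :* q) :=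
      con 2ℚ :* s₂ :* m₁ :+ con 2ℚ :* s₁ :* m₂ :+ s₁ :* s₂) refl

  K>0 : 0ℚ < K
  K>0 = +-mono-≤-< (+-mono-≤ (*-nonNeg (*-nonNeg 0≤2ℚ S₂≥0) (ℕ→ℚ-nonNeg n₁))
                             (*-nonNeg (*-nonNeg 0≤2ℚ S₁≥0) (ℕ→ℚ-nonNeg n₂)))
                   (*-pos (N₁.total-pos u) (N₂.total-pos v))

  instance
    K-nonZero : NonZero K
    K-nonZero = pos⇒nonZero K {{positive K>0}}

  scale : ℚ
  scale = ℕ→ℚ (n₁ +ℕ n₂) * 1/ K

  scale≥0 : 0ℚ ≤ scale
  scale≥0 = *-nonNeg (ℕ→ℚ-nonNeg (n₁ +ℕ n₂))
                     (<⇒≤ (positive⁻¹ (1/ K) {{1/pos⇒pos K {{positive K>0}}}}))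

  curvature : Fin (n₁ +ℕ n₂) → ℚ
  curvature x = scale * W x

  curvature-isCurvature : IsCurvature D curvature
  curvature-isCurvature = rescale-to-curvature {D = D} {W} K (↑-elim row-↑ˡ row-↑ʳ)

  curvature-u≤0 : curvature (u ↑ˡ n₂) ≤ 0ℚ
  curvature-u≤0 = *-nonNeg-nonPos scale≥0
    (subst (_≤ 0ℚ) (sym (trans (W-↑ˡ u) C₁.W-self)) (N₁.corrected-self≤0 u S₂≥0))

  curvature-v≤0 : curvature (n₁ ↑ʳ v) ≤ 0ℚ
  curvature-v≤0 = *-nonNeg-nonPos scale≥0
    (subst (_≤ 0ℚ) (sym (trans (W-↑ʳ v) C₂.W-self)) (N₂.corrected-self≤0 v S₁≥0))

  curvature-other≥0 : ∀ x → x ≢ u ↑ˡ n₂ → x ≢ n₁ ↑ʳ v → 0ℚ ≤ curvature x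
  curvature-other≥0 = ↑-elim
    (λ a a≢u _ → *-nonNeg scale≥0 (subst (0ℚ ≤_) (sym (W-↑ˡ a))
                   (C₁.W-other≥0 (*-nonNeg 0≤2ℚ S₂≥0) w₁≥0 (a≢u ∘ cong (_↑ˡ n₂)))))
    (λ b _ b≢v → *-nonNeg scale≥0 (subst (0ℚ ≤_) (sym (W-↑ʳ b))
                   (C₂.W-other≥0 (*-nonNeg 0≤2ℚ S₁≥0) w₂≥0 (b≢v ∘ cong (n₁ ↑ʳ_)))))

theorem2 : (n₁ n₂ : ℕ) (G₁ : Graph n₁) (G₂ : Graph n₂) →
    Connected G₁ → Connected G₂ →
    (D₁ : Fin n₁ → Fin n₁ → ℕ) → IsDistanceMatrix G₁ D₁ →
    (D₂ : Fin n₂ → Fin n₂ → ℕ) → IsDistanceMatrix G₂ D₂ →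
    (∃ λ (w₁ : Fin n₁ → ℚ) → IsCurvature D₁ w₁ × (∀ i → 0ℚ ≤ w₁ i)) →
    (∃ λ (w₂ : Fin n₂ → ℚ) → IsCurvature D₂ w₂ × (∀ i → 0ℚ ≤ w₂ i)) →
    (u : Fin n₁) (v : Fin n₂) →
    (D : Fin (n₁ +ℕ n₂) → Fin (n₁ +ℕ n₂) → ℕ) →
    IsDistanceMatrix (bridge G₁ G₂ u v) D →
    ∃ λ (w : Fin (n₁ +ℕ n₂) → ℚ) →
      IsCurvature D w
      × w (u ↑ˡ n₂) ≤ 0ℚ
      × w (n₁ ↑ʳ v) ≤ 0ℚ
      × (∀ x → ¬ (x ≡ u ↑ˡ n₂) → ¬ (x ≡ n₁ ↑ʳ v) → 0ℚ ≤ w x)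
theorem2 n₁ n₂ G₁ G₂ _ _ D₁ isD₁ D₂ isD₂ (w₁ , cw₁ , w₁≥0) (w₂ , cw₂ , w₂≥0) u v D isD =
  curvature , curvature-isCurvature , curvature-u≤0 , curvature-v≤0 , curvature-other≥0
  where open BridgeCurvature isD₁ isD₂ cw₁ w₁≥0 cw₂ w₂≥0 u v isD
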